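{- Let $n$ and $p$ be integers with $0\leq p\leq n-3$. Then every connected graph $G$ with $n$ vertices and $m=\binom{n}{2}-p$ edges satisfies $tmc(G)\geq\binom{n}{2}+n-3p$ if $0\leq p\leq\frac{n}{2}$, and $tmc(G)\geq\binom{n}{2}-p$ if $\frac{n}{2}<p\leq n-3$.
   Context: All graphs are finite, simple and undirected. A graph is total-colored if all its edges and all its vertices are assigned colors. A path in a total-colored graph is a total monochromatic path if all its edges and all its internal vertices have the same color. A total-coloring of a connected graph $G$ is a TMC-coloring if any two vertices of $G$ are joined by a total monochromatic path. The total monochromatic connection number $tmc(G)$ of a connected graph $G$ is the maximum number of colors used in a TMC-coloring of $G$. -}

module Defs where

open import Data.Nat using (ℕ; _<ᵇ_)
open import Data.Nat.Properties using (_≟_)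
open import Data.Bool using (Bool; true; false; _∧_)
open import Data.Fin using (Fin; toℕ)
open import Data.List using (List; []; _∷_; _++_; [_]; map; length; filterᵇ; cartesianProduct; allFin; deduplicate)
open import Data.List.Relation.Unary.All using (All)
open import Data.List.Relation.Unary.Unique.Propositional using (Unique)
open import Data.List.Relation.Unary.Linked using (Linked)
open import Data.Product using (Σ; _×_; _,_; proj₁; proj₂)
open import Relation.Binary.PropositionalEquality using (_≡_; _≢_)

record Graph (n : ℕ) : Set where
  field
    adj     : Fin n → Fin n → Bool
    adj-sym : ∀ u v → adj u v ≡ adj v u
    irrefl  : ∀ u → adj u u ≡ false
open Graph public

module _ {n : ℕ} (G : Graph n) where

  Adj : Fin n → Fin n → Set
  Adj u v = adj G u v ≡ true

  edges : List (Fin n × Fin n)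
  edges = filterᵇ (λ e → (toℕ (proj₁ e) <ᵇ toℕ (proj₂ e)) ∧ adj G (proj₁ e) (proj₂ e))
                  (cartesianProduct (allFin n) (allFin n))

  numEdges : ℕ
  numEdges = length edges

  record Path (u v : Fin n) : Set where
    field
      inner : List (Fin n)
      uniq  : Unique (u ∷ inner ++ [ v ])
      links : Linked Adj (u ∷ inner ++ [ v ])

  Connected : Set
  Connected = ∀ u v → u ≢ v → Path u v

-- A total coloring of G with colors in ℕ: a color for each vertex and a
-- color for each edge (edge colors given by a symmetric function; its
-- values on non-adjacent pairs are irrelevant).
record TotalColoring {n : ℕ} (G : Graph n) : Set where
  field
    vcol     : Fin n → ℕ
    ecol     : Fin n → Fin n → ℕ
    ecol-sym : ∀ u v → ecol u v ≡ ecol v u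
open TotalColoring public

module _ {n : ℕ} {G : Graph n} (χ : TotalColoring G) where

  record TMPath (u v : Fin n) : Set where
    field
      color : ℕ
      inner : List (Fin n)
      uniq  : Unique (u ∷ inner ++ [ v ])
      links : Linked (λ a b → Adj G a b × ecol χ a b ≡ color) (u ∷ inner ++ [ v ])
      innerCol : All (λ x → vcol χ x ≡ color) inner

  IsTMC : Set
  IsTMC = ∀ u v → u ≢ v → TMPath u v

  usedColors : List ℕ
  usedColors = map (vcol χ) (allFin n)
            ++ map (λ e → ecol χ (proj₁ e) (proj₂ e)) (edges G)

  numColors : ℕ
  numColors = length (deduplicate _≟_ usedColors)

-- tmc(G) ≥ k : since tmc(G) is the maximum number of colors used in a
-- TMC-coloring (a finite maximum), tmc(G) ≥ k iff some TMC-coloring uses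
-- at least k colors.
TmcAtLeast : {n : ℕ} → Graph n → ℕ → Set
TmcAtLeast G k = Σ (TotalColoring G) (λ χ → IsTMC χ × k Data.Nat.≤ numColors χ)

-- Let k ≤ p be the number of non-edges of G. Give colour 0 to a set S of centres and to a
-- set T of edges through them, and a colour of its own to every other vertex and edge; this
-- uses at least n + m + 1 − |S| − |T| colours. If some vertex w is adjacent to all others,
-- take S = {w} and join w to the at most 2k vertices lying on a non-edge: two non-adjacent
-- vertices are then joined through w, and m + n − 2k ≥ C(n,2) + n − 3p colours are used.
-- Since k < n − 1, every vertex w₀ lies on an edge w₀w₁ such that each vertex is adjacent to
-- w₀ or w₁ (otherwise each vertex can be charged a different non-edge). Joining w₀ to its
-- neighbours and w₁ to the remaining n − 1 − deg w₀ vertices gives a TMC-colouring with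
-- m = C(n,2) − p colours; this also settles the first bound when no vertex is universal,
-- since then every vertex lies on a non-edge and n ≤ 2k ≤ 2p.

module Submission where

open import Defs
open import Data.Bool using (true; false; if_then_else_)
import Data.Bool.Properties as Bool
open import Data.Empty using (⊥-elim)
open import Data.Fin as Fin using (Fin; toℕ; combine; _<?_) renaming (zero to fzero; suc to fsuc)
open import Data.Fin.Properties
  using (<-cmp; <-asym; toℕ-injective; toℕ<n; combine-injective; any?; all?; ¬∀⟶∃¬)
open import Data.List using (List; []; _∷_; _++_; length; map; filter; allFin; cartesianProduct)
open import Data.List.Properties using (length-++; length-++-sucʳ; length-map; length-tabulate; filter-notAll)
open import Data.List.Membership.Propositional using (_∈_; _∉_)
open import Data.List.Membership.Propositional.Properties
  using (∈-∃++; ∈-++⁻; ∈-++⁺ˡ; ∈-++⁺ʳ; ∈-map⁺; ∈-map⁻; ∈-filter⁺; ∈-filter⁻; ∈-allFin;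
         ∈-cartesianProduct⁺; ∈-deduplicate⁺)
import Data.List.Membership.DecPropositional as DecMembership
open import Data.List.Relation.Binary.Subset.Propositional using (_⊆_)
open import Data.List.Relation.Unary.All as All using ([]; _∷_)
import Data.List.Relation.Unary.All.Properties as Allₚ
open import Data.List.Relation.Unary.AllPairs using ([]; _∷_)
open import Data.List.Relation.Unary.Any as Any using (here; there)
open import Data.List.Relation.Unary.Linked using ([-]; _∷_)
open import Data.List.Relation.Unary.Unique.Propositional using (Unique)
open import Data.List.Relation.Unary.Unique.Propositional.Properties
  using (filter⁺; map⁺; ++⁺; cartesianProduct⁺; allFin⁺)
open import Data.Nat as ℕ using (ℕ; zero; suc; _+_; _*_; _∸_; _≤_; _<_; z≤n; s≤s)
open import Data.Nat.Combinatorics using (_C_; nC1≡n; nCk+nC[k+1]≡[n+1]C[k+1])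
open import Data.Nat.Properties
  using (≤-trans; ≤-reflexive; ≤-pred; <-irrefl; n≤1+n; m≤m+n; suc-injective; <ᵇ⇒<;
         +-comm; +-suc; +-identityʳ; +-cancelˡ-≡; +-cancelˡ-≤; +-mono-≤; +-monoˡ-≤; +-monoʳ-≤;
         *-monoʳ-≤; m+n≤o⇒n≤o; m∸n+n≡m; m≤n+o⇒m∸n≤o; [m+n]∸[m+o]≡n∸o; ∸-monoʳ-≤;
         module ≤-Reasoning)
open import Data.Nat.Tactic.RingSolver using (solve-∀)
open import Data.Product using (∃; _×_; _,_; proj₁; proj₂; swap)
open import Data.Product.Properties using (,-injective; ≡-dec)
open import Data.Sum using (_⊎_; inj₁; inj₂; [_,_])
open import Function using (_∘_)
open import Function.Bundles using (Equivalence)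
open import Relation.Binary.Definitions using (DecidableEquality; tri<; tri≈; tri>)
open import Relation.Binary.PropositionalEquality
  using (_≡_; _≢_; refl; sym; trans; cong; cong₂; subst; subst₂; module ≡-Reasoning)
open import Relation.Nullary using (Dec; yes; no; does; ¬_; ¬?)
open import Relation.Nullary.Decidable using (dec-true; dec-false; _×-dec_; _⊎-dec_)
open import Relation.Unary using (Pred; Decidable)
open import Relation.Unary.Properties using (∁?)

module _ {a} {A : Set a} where

  private
    ∈-++-∷-remove : ∀ {x y} (as bs : List A) → y ∈ as ++ x ∷ bs → y ≢ x → y ∈ as ++ bs
    ∈-++-∷-remove {x} as bs y∈ y≢x with ∈-++⁻ as y∈
    ... | inj₁ y∈as         = ∈-++⁺ˡ y∈as
    ... | inj₂ (here y≡x)   = ⊥-elim (y≢x y≡x)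
    ... | inj₂ (there y∈bs) = ∈-++⁺ʳ as y∈bs

  Unique-⊆⇒length≤ : ∀ {xs ys : List A} → Unique xs → xs ⊆ ys → length xs ≤ length ys
  Unique-⊆⇒length≤ {[]}     _            _   = z≤n
  Unique-⊆⇒length≤ {x ∷ xs} (x∉xs ∷ uxs) sub with ∈-∃++ (sub (here refl))
  ... | as , bs , refl =
    subst (suc (length xs) ≤_) (sym (length-++-sucʳ as x bs))
      (s≤s (Unique-⊆⇒length≤ uxs λ y∈xs →
        ∈-++-∷-remove as bs (sub (there y∈xs)) (λ { refl → All.lookup x∉xs y∈xs refl })))

  length-filter-∁ : ∀ {p} {P : Pred A p} (P? : Decidable P) (xs : List A) →
                    length (filter P? xs) + length (filter (∁? P?) xs) ≡ length xs
  length-filter-∁ P? []       = refl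
  length-filter-∁ P? (x ∷ xs) with does (P? x)
  ... | true  = cong suc (length-filter-∁ P? xs)
  ... | false = trans (+-suc _ _) (cong suc (length-filter-∁ P? xs))

module _ {a} {A : Set a} (_≟_ : DecidableEquality A) where

  open DecMembership _≟_ using (_∈?_; _∉?_)

  length≤length+length-∉ : ∀ {xs} (ys : List A) → Unique xs →
                           length xs ≤ length ys + length (filter (_∉? ys) xs)
  length≤length+length-∉ {xs} ys uxs = ≤-trans
    (≤-reflexive (sym (length-filter-∁ (_∈? ys) xs)))
    (+-monoˡ-≤ _ (Unique-⊆⇒length≤ (filter⁺ (_∈? ys) uxs)
                                     (λ x∈ → proj₂ (∈-filter⁻ (_∈? ys) {xs = xs} x∈))))

length-allFin : ∀ n → length (allFin n) ≡ n
length-allFin n = length-tabulate {n = n} (λ i → i)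

endpoints : ∀ {a} {A : Set a} → List (A × A) → List A
endpoints es = map proj₁ es ++ map proj₂ es

length-endpoints : ∀ {a} {A : Set a} (es : List (A × A)) → length (endpoints es) ≡ length es + length es
length-endpoints es =
  trans (length-++ (map proj₁ es)) (cong₂ _+_ (length-map proj₁ es) (length-map proj₂ es))

module _ {n : ℕ} where

  sortedPair : Fin n → Fin n → Fin n × Fin n
  sortedPair u v = if does (u <? v) then (u , v) else (v , u)

  sortedPair-< : ∀ {u v} → u Fin.< v → sortedPair u v ≡ (u , v)
  sortedPair-< {u} {v} u<v rewrite dec-true (u <? v) u<v = refl

  sortedPair-> : ∀ {u v} → v Fin.< u → sortedPair u v ≡ (v , u)
  sortedPair-> {u} {v} v<u rewrite dec-false (u <? v) (<-asym v<u) = refl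

  sortedPair-comm : ∀ u v → sortedPair u v ≡ sortedPair v u
  sortedPair-comm u v with <-cmp u v
  ... | tri< u<v _ _    = trans (sortedPair-< u<v) (sym (sortedPair-> u<v))
  ... | tri≈ _ refl _   = refl
  ... | tri> _ _ v<u    = trans (sortedPair-> v<u) (sym (sortedPair-< v<u))

  sortedPair-cases : ∀ u v → sortedPair u v ≡ (u , v) ⊎ sortedPair u v ≡ (v , u)
  sortedPair-cases u v with does (u <? v)
  ... | true  = inj₁ refl
  ... | false = inj₂ refl

  sortedPair-injective : ∀ {a b c d} → sortedPair a b ≡ sortedPair c d →
                         (a ≡ c × b ≡ d) ⊎ (a ≡ d × b ≡ c)
  sortedPair-injective {a} {b} {c} {d} eq
    with sortedPair-cases a b | sortedPair-cases c d
  ... | inj₁ p | inj₁ q = inj₁ (,-injective (trans (sym p) (trans eq q)))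
  ... | inj₁ p | inj₂ q = inj₂ (,-injective (trans (sym p) (trans eq q)))
  ... | inj₂ p | inj₁ q = inj₂ (swap (,-injective (trans (sym p) (trans eq q))))
  ... | inj₂ p | inj₂ q = inj₁ (swap (,-injective (trans (sym p) (trans eq q))))

  sortedPair-endpoints : ∀ {u v} {es : List (Fin n × Fin n)} → sortedPair u v ∈ es →
                         u ∈ endpoints es
  sortedPair-endpoints {u} {v} {es} uv∈ with sortedPair-cases u v
  ... | inj₁ p = ∈-++⁺ˡ (∈-map⁺ proj₁ (subst (_∈ es) p uv∈))
  ... | inj₂ p = ∈-++⁺ʳ (map proj₁ es) (∈-map⁺ proj₂ (subst (_∈ es) p uv∈))

increasingPairs : ∀ n → List (Fin n × Fin n)
increasingPairs zero    = []
increasingPairs (suc n) = map (λ j → fzero , fsuc j) (allFin n)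
                       ++ map (λ e → fsuc (proj₁ e) , fsuc (proj₂ e)) (increasingPairs n)

length-increasingPairs : ∀ n → length (increasingPairs n) ≡ n C 2
length-increasingPairs zero    = refl
length-increasingPairs (suc n) = begin
  length (increasingPairs (suc n))  ≡⟨ length-++ (map (λ j → fzero , fsuc j) (allFin n)) ⟩
  length (map _ (allFin n)) + length (map _ (increasingPairs n))
    ≡⟨ cong₂ _+_ (trans (length-map _ (allFin n)) (length-allFin n)) (length-map _ (increasingPairs n)) ⟩
  n + length (increasingPairs n)    ≡⟨ cong₂ _+_ (sym (nC1≡n n)) (length-increasingPairs n) ⟩
  n C 1 + n C 2                     ≡⟨ nCk+nC[k+1]≡[n+1]C[k+1] n 1 ⟩
  suc n C 2                         ∎
  where open ≡-Reasoning

∈-increasingPairs : ∀ {n} {i j : Fin n} → i Fin.< j → (i , j) ∈ increasingPairs n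
∈-increasingPairs {suc n} {fzero}  {fsuc j} _         = ∈-++⁺ˡ (∈-map⁺ _ (∈-allFin j))
∈-increasingPairs {suc n} {fsuc i} {fsuc j} (s≤s i<j) =
  ∈-++⁺ʳ (map _ (allFin n))
         (∈-map⁺ (λ e → fsuc (proj₁ e) , fsuc (proj₂ e)) (∈-increasingPairs i<j))

TmcAtLeast-mono : ∀ {n} {G : Graph n} {j k} → j ≤ k → TmcAtLeast G k → TmcAtLeast G j
TmcAtLeast-mono j≤k (χ , isTMC , k≤colours) = χ , isTMC , ≤-trans j≤k k≤colours

-- Edges and non-edges

module _ {n : ℕ} (G : Graph n) where

  Adj? : ∀ u v → Dec (Adj G u v)
  Adj? u v = adj G u v Bool.≟ true

  Adj-sym : ∀ {u v} → Adj G u v → Adj G v u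
  Adj-sym {u} {v} uv = trans (adj-sym G v u) uv

  Adj⇒≢ : ∀ {u v} → Adj G u v → u ≢ v
  Adj⇒≢ {u} uu refl with trans (sym (irrefl G u)) uu
  ... | ()

  private
    vertexPairs : List (Fin n × Fin n)
    vertexPairs = cartesianProduct (allFin n) (allFin n)

    Unique-vertexPairs : Unique vertexPairs
    Unique-vertexPairs = cartesianProduct⁺ (allFin⁺ n) (allFin⁺ n)

  nonEdges : List (Fin n × Fin n)
  nonEdges = filter (λ e → proj₁ e <? proj₂ e ×-dec ¬? (Adj? (proj₁ e) (proj₂ e))) vertexPairs

  Unique-edges : Unique (edges G)
  Unique-edges = filter⁺ _ Unique-vertexPairs

  Unique-nonEdges : Unique nonEdges
  Unique-nonEdges = filter⁺ _ Unique-vertexPairs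

  ∈-edges⁻ : ∀ {e} → e ∈ edges G → proj₁ e Fin.< proj₂ e × Adj G (proj₁ e) (proj₂ e)
  ∈-edges⁻ {u , v} e∈ with Equivalence.to Bool.T-∧ (proj₂ (∈-filter⁻ _ {xs = vertexPairs} e∈))
  ... | u<ᵇv , uv = <ᵇ⇒< (toℕ u) (toℕ v) u<ᵇv , Equivalence.to Bool.T-≡ uv

  ∈-nonEdges⁻ : ∀ {e} → e ∈ nonEdges → proj₁ e Fin.< proj₂ e
  ∈-nonEdges⁻ e∈ = proj₁ (proj₂ (∈-filter⁻ _ {xs = vertexPairs} e∈))

  sortedPair-edges : ∀ {e} → e ∈ edges G → sortedPair (proj₁ e) (proj₂ e) ≡ e
  sortedPair-edges e∈ = sortedPair-< (proj₁ (∈-edges⁻ e∈))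

  sortedPair∈nonEdges : ∀ {u v} → u ≢ v → ¬ Adj G u v → sortedPair u v ∈ nonEdges
  sortedPair∈nonEdges {u} {v} u≢v ¬uv with <-cmp u v
  ... | tri< u<v _ _ = subst (_∈ nonEdges) (sym (sortedPair-< u<v))
                         (∈-filter⁺ _ (∈-cartesianProduct⁺ (∈-allFin u) (∈-allFin v)) (u<v , ¬uv))
  ... | tri≈ _ u≡v _ = ⊥-elim (u≢v u≡v)
  ... | tri> _ _ v<u = subst (_∈ nonEdges) (sym (sortedPair-> v<u))
                         (∈-filter⁺ _ (∈-cartesianProduct⁺ (∈-allFin v) (∈-allFin u))
                                      (v<u , ¬uv ∘ Adj-sym))

  numEdges+length-nonEdges≤nC2 : numEdges G + length nonEdges ≤ n C 2
  numEdges+length-nonEdges≤nC2 = subst₂ _≤_ (length-++ (edges G)) (length-increasingPairs n)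
    (Unique-⊆⇒length≤ (++⁺ Unique-edges Unique-nonEdges disjoint) increasing)
    where
    disjoint : ∀ {e} → ¬ (e ∈ edges G × e ∈ nonEdges)
    disjoint (e∈E , e∈N) =
      proj₂ (proj₂ (∈-filter⁻ _ {xs = vertexPairs} e∈N)) (proj₂ (∈-edges⁻ e∈E))
    increasing : edges G ++ nonEdges ⊆ increasingPairs n
    increasing e∈ with ∈-++⁻ (edges G) e∈
    ... | inj₁ e∈E = ∈-increasingPairs (proj₁ (∈-edges⁻ e∈E))
    ... | inj₂ e∈N = ∈-increasingPairs (∈-nonEdges⁻ e∈N)

  module MonochromaticPaths (χ : TotalColoring G) where

    MonoEdge : ℕ → Fin n → Fin n → Set
    MonoEdge c u v = Adj G u v × ecol χ u v ≡ c

    MonoEdge-sym : ∀ {c u v} → MonoEdge c u v → MonoEdge c v u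
    MonoEdge-sym {u = u} {v} (uv , col) = Adj-sym uv , trans (ecol-sym χ v u) col

    tmPath-edge : ∀ {u v} → u ≢ v → Adj G u v → TMPath χ u v
    tmPath-edge u≢v uv = record
      { color = ecol χ _ _ ; inner = []
      ; uniq = (u≢v ∷ []) ∷ [] ∷ []
      ; links = (uv , refl) ∷ [-]
      ; innerCol = [] }

    tmPath-via : ∀ {c u a v} → u ≢ v → MonoEdge c u a → MonoEdge c a v → vcol χ a ≡ c →
                 TMPath χ u v
    tmPath-via u≢v ua av a-col = record
      { color = _ ; inner = _ ∷ []
      ; uniq = (Adj⇒≢ (proj₁ ua) ∷ u≢v ∷ []) ∷ (Adj⇒≢ (proj₁ av) ∷ []) ∷ [] ∷ []
      ; links = ua ∷ av ∷ [-]
      ; innerCol = a-col ∷ [] }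

    tmPath-via₂ : ∀ {c u a b v} → u ≢ v → u ≢ b → a ≢ v →
                  MonoEdge c u a → MonoEdge c a b → MonoEdge c b v →
                  vcol χ a ≡ c → vcol χ b ≡ c → TMPath χ u v
    tmPath-via₂ u≢v u≢b a≢v ua ab bv a-col b-col = record
      { color = _ ; inner = _ ∷ _ ∷ []
      ; uniq = (Adj⇒≢ (proj₁ ua) ∷ u≢b ∷ u≢v ∷ [])
             ∷ (Adj⇒≢ (proj₁ ab) ∷ a≢v ∷ []) ∷ (Adj⇒≢ (proj₁ bv) ∷ []) ∷ [] ∷ []
      ; links = ua ∷ ab ∷ bv ∷ [-]
      ; innerCol = a-col ∷ b-col ∷ [] }

  -- Colourings with a single colour class

  module Centred (S : List (Fin n)) (T : List (Fin n × Fin n)) where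

    private
      _≟ᵖ_ : DecidableEquality (Fin n × Fin n)
      _≟ᵖ_ = ≡-dec Fin._≟_ Fin._≟_
      module V = DecMembership (Fin._≟_ {n})
      module P = DecMembership _≟ᵖ_

    vertexCode : Fin n → ℕ
    vertexCode x = suc (toℕ x)

    edgeCode : Fin n × Fin n → ℕ
    edgeCode e = suc (n + toℕ (combine (proj₁ e) (proj₂ e)))

    colouring : TotalColoring G
    colouring = record
      { vcol     = λ x → if does (x V.∈? S) then 0 else vertexCode x
      ; ecol     = λ u v → edgeColour (sortedPair u v)
      ; ecol-sym = λ u v → cong edgeColour (sortedPair-comm u v) }
      where
      edgeColour : Fin n × Fin n → ℕ
      edgeColour e = if does (e P.∈? T) then 0 else edgeCode e

    vcol-centre : ∀ {x} → x ∈ S → vcol colouring x ≡ 0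
    vcol-centre {x} x∈S rewrite dec-true (x V.∈? S) x∈S = refl

    MonoEdge-tree : ∀ {u v} → Adj G u v → sortedPair u v ∈ T → MonochromaticPaths.MonoEdge colouring 0 u v
    MonoEdge-tree {u} {v} uv uv∈T rewrite dec-true (sortedPair u v P.∈? T) uv∈T = uv , refl

    private
      Vs : List (Fin n)
      Vs = filter (V._∉? S) (allFin n)

      Es : List (Fin n × Fin n)
      Es = filter (P._∉? T) (edges G)

      vertexCode-injective : ∀ {x y} → vertexCode x ≡ vertexCode y → x ≡ y
      vertexCode-injective = toℕ-injective ∘ suc-injective

      edgeCode-injective : ∀ {e f} → edgeCode e ≡ edgeCode f → e ≡ f
      edgeCode-injective {e} {f} eq =
        let (p , q) = combine-injective (proj₁ e) (proj₂ e) (proj₁ f) (proj₂ f)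
                        (toℕ-injective (+-cancelˡ-≡ n _ _ (suc-injective eq)))
        in cong₂ _,_ p q

      vertexCode<edgeCode : ∀ x e → vertexCode x < edgeCode e
      vertexCode<edgeCode x e = s≤s (≤-trans (toℕ<n x) (m≤m+n n _))

      palette : List ℕ
      palette = 0 ∷ map vertexCode Vs ++ map edgeCode Es

      Unique-palette : Unique palette
      Unique-palette =
        Allₚ.++⁺ (Allₚ.map⁺ (All.universal (λ _ ()) Vs)) (Allₚ.map⁺ (All.universal (λ _ ()) Es))
        ∷ ++⁺ (map⁺ vertexCode-injective (filter⁺ _ (allFin⁺ n)))
              (map⁺ edgeCode-injective (filter⁺ _ Unique-edges))
              disjoint
        where
        disjoint : ∀ {c} → ¬ (c ∈ map vertexCode Vs × c ∈ map edgeCode Es)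
        disjoint (c∈V , c∈E) with ∈-map⁻ vertexCode c∈V | ∈-map⁻ edgeCode c∈E
        ... | x , _ , refl | e , _ , eq = <-irrefl eq (vertexCode<edgeCode x e)

      vcol-leaf : ∀ {x} → x ∉ S → vcol colouring x ≡ vertexCode x
      vcol-leaf {x} x∉S rewrite dec-false (x V.∈? S) x∉S = refl

      ecol-edge : ∀ {e} → e ∈ edges G → e ∉ T → ecol colouring (proj₁ e) (proj₂ e) ≡ edgeCode e
      ecol-edge {e} e∈E e∉T rewrite sortedPair-edges e∈E | dec-false (e P.∈? T) e∉T = refl

      palette⊆usedColors : ∀ {w} → w ∈ S → palette ⊆ usedColors colouring
      palette⊆usedColors {w} w∈S (here refl) =
        ∈-++⁺ˡ (subst (_∈ _) (vcol-centre w∈S) (∈-map⁺ (vcol colouring) (∈-allFin w)))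
      palette⊆usedColors w∈S (there c∈) with ∈-++⁻ (map vertexCode Vs) c∈
      ... | inj₁ c∈V with x , x∈Vs , refl ← ∈-map⁻ vertexCode c∈V =
        ∈-++⁺ˡ (subst (_∈ _) (vcol-leaf (proj₂ (∈-filter⁻ (V._∉? S) {xs = allFin n} x∈Vs)))
                                 (∈-map⁺ (vcol colouring) (∈-allFin x)))
      ... | inj₂ c∈E with e , e∈Es , refl ← ∈-map⁻ edgeCode c∈E =
        let (e∈E , e∉T) = ∈-filter⁻ (P._∉? T) {xs = edges G} e∈Es in
        ∈-++⁺ʳ (map (vcol colouring) (allFin n))
          (subst (_∈ _) (ecol-edge e∈E e∉T)
                 (∈-map⁺ (λ e → ecol colouring (proj₁ e) (proj₂ e)) e∈E))

    numColors-colouring : ∀ {w} → w ∈ S →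
                          suc (n + numEdges G) ≤ numColors colouring + (length S + length T)
    numColors-colouring w∈S = begin
      suc (n + numEdges G)
        ≤⟨ s≤s (+-mono-≤ (subst (_≤ length S + length Vs) (length-allFin n)
                                 (length≤length+length-∉ Fin._≟_ S (allFin⁺ n)))
                          (length≤length+length-∉ _≟ᵖ_ T Unique-edges)) ⟩
      suc ((length S + length Vs) + (length T + length Es))
        ≡⟨ rearrange (length S) (length Vs) (length T) (length Es) ⟩
      suc (length Vs + length Es) + (length S + length T)
        ≡⟨ cong (_+ (length S + length T)) (sym length-palette) ⟩
      length palette + (length S + length T)
        ≤⟨ +-monoˡ-≤ (length S + length T)
             (Unique-⊆⇒length≤ Unique-palette (∈-deduplicate⁺ ℕ._≟_ ∘ palette⊆usedColors w∈S)) ⟩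
      numColors colouring + (length S + length T) ∎
      where
      open ≤-Reasoning
      rearrange : ∀ a b c d → suc ((a + b) + (c + d)) ≡ suc (b + d) + (a + c)
      rearrange = solve-∀
      length-palette : length palette ≡ suc (length Vs + length Es)
      length-palette = cong suc (trans (length-++ (map vertexCode Vs))
                                       (cong₂ _+_ (length-map _ Vs) (length-map _ Es)))

  -- Stars and double stars

  Universal : Fin n → Set
  Universal w = ∀ x → x ≡ w ⊎ Adj G w x

  universal? : Dec (∃ Universal)
  universal? = any? λ w → all? λ x → x Fin.≟ w ⊎-dec Adj? w x

  DominatingEdge : Fin n → Fin n → Set
  DominatingEdge w₀ w₁ = Adj G w₀ w₁ × (∀ x → x ≡ w₀ ⊎ Adj G w₀ x ⊎ Adj G w₁ x)

  dominatingEdge? : ∀ w₀ → Dec (∃ (DominatingEdge w₀))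
  dominatingEdge? w₀ =
    any? λ w₁ → Adj? w₀ w₁ ×-dec all? λ x → x Fin.≟ w₀ ⊎-dec Adj? w₀ x ⊎-dec Adj? w₁ x

  tmc-star : ∀ {w} → Universal w → TmcAtLeast G ((numEdges G + n) ∸ 2 * length nonEdges)
  tmc-star {w} universal = colouring , isTMC , bound
    where
    open Centred (w ∷ []) (map (sortedPair w) (endpoints nonEdges))
    open MonochromaticPaths colouring

    spoke : ∀ {x} → x ∈ endpoints nonEdges → x ≢ w → MonoEdge 0 w x
    spoke {x} x∈ x≢w with universal x
    ... | inj₁ x≡w = ⊥-elim (x≢w x≡w)
    ... | inj₂ wx  = MonoEdge-tree wx (∈-map⁺ (sortedPair w) x∈)

    isTMC : IsTMC colouring
    isTMC u v u≢v with Adj? u v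
    ... | yes uv = tmPath-edge u≢v uv
    ... | no ¬uv = tmPath-via u≢v
                     (MonoEdge-sym (spoke (sortedPair-endpoints (sortedPair∈nonEdges u≢v ¬uv)) u≢w))
                     (spoke (sortedPair-endpoints (sortedPair∈nonEdges (u≢v ∘ sym) (¬uv ∘ Adj-sym))) v≢w)
                     (vcol-centre (here refl))
      where
      u≢w : u ≢ w
      u≢w refl = [ (λ v≡w → u≢v (sym v≡w)) , ¬uv ] (universal v)
      v≢w : v ≢ w
      v≢w refl = [ u≢v , ¬uv ∘ Adj-sym ] (universal u)

    bound : (numEdges G + n) ∸ 2 * length nonEdges ≤ numColors colouring
    bound = m≤n+o⇒m∸n≤o (numEdges G + n) _ (+-cancelˡ-≤ 1 _ _ (begin
      suc (numEdges G + n)             ≡⟨ cong suc (+-comm (numEdges G) n) ⟩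
      suc (n + numEdges G)             ≤⟨ numColors-colouring (here refl) ⟩
      numColors colouring + (1 + length (map (sortedPair w) (endpoints nonEdges)))
        ≡⟨ cong (λ t → numColors colouring + (1 + t))
                (trans (length-map (sortedPair w) (endpoints nonEdges)) (length-endpoints nonEdges)) ⟩
      numColors colouring + (1 + (length nonEdges + length nonEdges))
        ≡⟨ rearrange (numColors colouring) (length nonEdges) ⟩
      1 + (2 * length nonEdges + numColors colouring) ∎))
      where
      open ≤-Reasoning
      rearrange : ∀ c k → c + (1 + (k + k)) ≡ 1 + (2 * k + c)
      rearrange = solve-∀

  tmc-doubleStar : ∀ {w₀ w₁} → DominatingEdge w₀ w₁ → TmcAtLeast G (numEdges G)
  tmc-doubleStar {w₀} {w₁} (w₀w₁ , dominating) = colouring , isTMC , bound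
    where
    hub : Fin n → Fin n
    hub y = if adj G w₀ y then w₀ else w₁

    leaves : List (Fin n)
    leaves = filter (λ y → ¬? (y Fin.≟ w₀)) (allFin n)

    open Centred (w₀ ∷ w₁ ∷ []) (map (λ y → sortedPair (hub y) y) leaves)
    open MonochromaticPaths colouring

    hub-near : ∀ {y} → Adj G w₀ y → hub y ≡ w₀
    hub-near w₀y rewrite w₀y = refl

    hub-far : ∀ {y} → ¬ Adj G w₀ y → hub y ≡ w₁
    hub-far ¬w₀y rewrite Bool.¬-not ¬w₀y = refl

    spoke : ∀ {h y} → y ≢ w₀ → hub y ≡ h → Adj G h y → MonoEdge 0 h y
    spoke {y = y} y≢w₀ refl hy =
      MonoEdge-tree hy (∈-map⁺ (λ y → sortedPair (hub y) y) (∈-filter⁺ _ (∈-allFin y) y≢w₀))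

    spoke₀ : ∀ {y} → Adj G w₀ y → MonoEdge 0 w₀ y
    spoke₀ w₀y = spoke (Adj⇒≢ w₀y ∘ sym) (hub-near w₀y) w₀y

    spoke₁ : ∀ {y} → y ≢ w₀ → ¬ Adj G w₀ y → MonoEdge 0 w₁ y
    spoke₁ {y} y≢w₀ ¬w₀y with dominating y
    ... | inj₁ y≡w₀       = ⊥-elim (y≢w₀ y≡w₀)
    ... | inj₂ (inj₁ w₀y) = ⊥-elim (¬w₀y w₀y)
    ... | inj₂ (inj₂ w₁y) = spoke y≢w₀ (hub-far ¬w₀y) w₁y

    axle : MonoEdge 0 w₀ w₁
    axle = spoke₀ w₀w₁

    data Role (x : Fin n) : Set where
      centre : x ≡ w₀ → Role x
      near   : Adj G w₀ x → Role x
      far    : x ≢ w₀ → ¬ Adj G w₀ x → Role x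

    role : ∀ x → Role x
    role x with x Fin.≟ w₀ | Adj? w₀ x
    ... | yes x≡w₀ | _        = centre x≡w₀
    ... | no _     | yes w₀x  = near w₀x
    ... | no x≢w₀  | no ¬w₀x  = far x≢w₀ ¬w₀x

    w₀-colour : vcol colouring w₀ ≡ 0
    w₀-colour = vcol-centre (here refl)

    w₁-colour : vcol colouring w₁ ≡ 0
    w₁-colour = vcol-centre (there (here refl))

    joinNonAdjacent : ∀ {u v} → u ≢ v → ¬ Adj G u v → Role u → Role v → TMPath colouring u v
    joinNonAdjacent u≢v ¬uv (centre refl) (centre refl) = ⊥-elim (u≢v refl)
    joinNonAdjacent u≢v ¬uv (centre refl) (near w₀v)   = ⊥-elim (¬uv w₀v)
    joinNonAdjacent u≢v ¬uv (near w₀u)   (centre refl) = ⊥-elim (¬uv (Adj-sym w₀u))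
    joinNonAdjacent u≢v ¬uv (centre refl) (far v≢w₀ ¬w₀v) =
      tmPath-via u≢v axle (spoke₁ v≢w₀ ¬w₀v) w₁-colour
    joinNonAdjacent u≢v ¬uv (far u≢w₀ ¬w₀u) (centre refl) =
      tmPath-via u≢v (MonoEdge-sym (spoke₁ u≢w₀ ¬w₀u)) (MonoEdge-sym axle) w₁-colour
    joinNonAdjacent u≢v ¬uv (near w₀u) (near w₀v) =
      tmPath-via u≢v (MonoEdge-sym (spoke₀ w₀u)) (spoke₀ w₀v) w₀-colour
    joinNonAdjacent u≢v ¬uv (far u≢w₀ ¬w₀u) (far v≢w₀ ¬w₀v) =
      tmPath-via u≢v (MonoEdge-sym (spoke₁ u≢w₀ ¬w₀u)) (spoke₁ v≢w₀ ¬w₀v) w₁-colour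
    joinNonAdjacent u≢v ¬uv (near w₀u) (far v≢w₀ ¬w₀v) =
      tmPath-via₂ u≢v u≢w₁ (v≢w₀ ∘ sym)
        (MonoEdge-sym (spoke₀ w₀u)) axle (spoke₁ v≢w₀ ¬w₀v) w₀-colour w₁-colour
      where
      u≢w₁ : _ ≢ w₁
      u≢w₁ refl = ¬uv (proj₁ (spoke₁ v≢w₀ ¬w₀v))
    joinNonAdjacent u≢v ¬uv (far u≢w₀ ¬w₀u) (near w₀v) =
      tmPath-via₂ u≢v u≢w₀ w₁≢v
        (MonoEdge-sym (spoke₁ u≢w₀ ¬w₀u)) (MonoEdge-sym axle) (spoke₀ w₀v) w₁-colour w₀-colour
      where
      w₁≢v : w₁ ≢ _
      w₁≢v refl = ¬uv (Adj-sym (proj₁ (spoke₁ u≢w₀ ¬w₀u)))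

    isTMC : IsTMC colouring
    isTMC u v u≢v with Adj? u v
    ... | yes uv = tmPath-edge u≢v uv
    ... | no ¬uv = joinNonAdjacent u≢v ¬uv (role u) (role v)

    bound : numEdges G ≤ numColors colouring
    bound = +-cancelˡ-≤ (suc n) _ _ (begin
      suc n + numEdges G                    ≤⟨ numColors-colouring (here refl) ⟩
      numColors colouring + (2 + length (map (λ y → sortedPair (hub y) y) leaves))
        ≡⟨ cong (λ t → numColors colouring + (2 + t)) (length-map _ leaves) ⟩
      numColors colouring + (2 + length leaves)
        ≤⟨ +-monoʳ-≤ (numColors colouring) (s≤s w₀∉leaves) ⟩
      numColors colouring + (1 + length (allFin n))
        ≡⟨ cong (λ t → numColors colouring + suc t) (length-allFin n) ⟩
      numColors colouring + suc n           ≡⟨ +-comm (numColors colouring) (suc n) ⟩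
      suc n + numColors colouring ∎)
      where
      open ≤-Reasoning
      w₀∉leaves : length leaves < length (allFin n)
      w₀∉leaves = filter-notAll _ (allFin n) (Any.map (λ { refl ¬w₀≡w₀ → ¬w₀≡w₀ refl }) (∈-allFin w₀))

  n≤2*length-nonEdges : (∀ w → ¬ Universal w) → n ≤ 2 * length nonEdges
  n≤2*length-nonEdges none = begin
    n                                   ≡⟨ length-allFin n ⟨
    length (allFin n)                   ≤⟨ Unique-⊆⇒length≤ (allFin⁺ n) (λ _ → nonUniversal∈endpoints _) ⟩
    length (endpoints nonEdges)         ≡⟨ length-endpoints nonEdges ⟩
    length nonEdges + length nonEdges   ≡⟨ cong (length nonEdges +_) (+-identityʳ (length nonEdges)) ⟨
    2 * length nonEdges                 ∎
    where
    open ≤-Reasoning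
    nonUniversal∈endpoints : ∀ w → w ∈ endpoints nonEdges
    nonUniversal∈endpoints w
      with x , ¬[x≡w⊎wx] ← ¬∀⟶∃¬ n _ (λ x → x Fin.≟ w ⊎-dec Adj? w x) (none w) =
      sortedPair-endpoints (sortedPair∈nonEdges (¬[x≡w⊎wx] ∘ inj₁ ∘ sym) (¬[x≡w⊎wx] ∘ inj₂))

  module Undominated (w₀ : Fin n) (undominated : ¬ ∃ (DominatingEdge w₀)) where

    escape : ∀ y → Adj G w₀ y → ∃ λ x → ¬ Adj G w₀ x × ¬ Adj G y x
    escape y w₀y
      with x , ¬dom ← ¬∀⟶∃¬ n _ (λ x → x Fin.≟ w₀ ⊎-dec Adj? w₀ x ⊎-dec Adj? y x)
                                (λ dom → undominated (y , w₀y , dom)) =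
      x , ¬dom ∘ inj₂ ∘ inj₁ , ¬dom ∘ inj₂ ∘ inj₂

    -- y is charged the non-edge {w₀, y} if it is not adjacent to w₀, and otherwise {y, x} for
    -- a vertex x missed by the edge w₀y; w₀ itself is charged the dummy pair (w₀, w₀).
    data Charged (y : Fin n) : Fin n → Set where
      outside : ¬ Adj G w₀ y → Charged y w₀
      inside  : ∀ {x} → Adj G w₀ y → ¬ Adj G w₀ x → ¬ Adj G y x → Charged y x

    charged : ∀ y → ∃ (Charged y)
    charged y with Adj? w₀ y
    ... | no ¬w₀y = w₀ , outside ¬w₀y
    ... | yes w₀y = let (x , ¬w₀x , ¬yx) = escape y w₀y in x , inside w₀y ¬w₀x ¬yx

    charge : Fin n → Fin n × Fin n
    charge y = sortedPair y (proj₁ (charged y))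

    charge-injective : ∀ {y y′} → charge y ≡ charge y′ → y ≡ y′
    charge-injective {y} {y′} eq with charged y | charged y′ | sortedPair-injective eq
    ... | _ | _ | inj₁ (y≡y′ , _) = y≡y′
    ... | _ , outside _ | _ , outside _ | inj₂ (y≡w₀ , w₀≡y′) = trans y≡w₀ w₀≡y′
    ... | _ , outside _ | _ , inside w₀y′ _ _ | inj₂ (_ , w₀≡y′) = ⊥-elim (Adj⇒≢ w₀y′ w₀≡y′)
    ... | _ , inside w₀y _ _ | _ , outside _ | inj₂ (y≡w₀ , _) = ⊥-elim (Adj⇒≢ w₀y (sym y≡w₀))
    ... | _ , inside w₀y _ _ | _ , inside _ ¬w₀x′ _ | inj₂ (y≡x′ , _) =
      ⊥-elim (¬w₀x′ (subst (Adj G w₀) y≡x′ w₀y))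

    charge∈nonEdges : ∀ y → charge y ∈ sortedPair w₀ w₀ ∷ nonEdges
    charge∈nonEdges y with charged y
    ... | _ , inside w₀y ¬w₀x ¬yx = there (sortedPair∈nonEdges (λ { refl → ¬w₀x w₀y }) ¬yx)
    ... | _ , outside ¬w₀y with y Fin.≟ w₀
    ...   | yes refl  = here refl
    ...   | no y≢w₀   = there (sortedPair∈nonEdges y≢w₀ (¬w₀y ∘ Adj-sym))

    n≤1+length-nonEdges : n ≤ suc (length nonEdges)
    n≤1+length-nonEdges =
      subst (_≤ suc (length nonEdges)) (trans (length-map charge (allFin n)) (length-allFin n))
        (Unique-⊆⇒length≤ (map⁺ charge-injective (allFin⁺ n)) charges⊆)
      where
      charges⊆ : map charge (allFin n) ⊆ sortedPair w₀ w₀ ∷ nonEdges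
      charges⊆ c∈ with y , _ , refl ← ∈-map⁻ charge c∈ = charge∈nonEdges y

  dominatingEdge : 2 + length nonEdges ≤ n → (w₀ : Fin n) → ∃ (DominatingEdge w₀)
  dominatingEdge 2+k≤n w₀ with dominatingEdge? w₀
  ... | yes found     = found
  ... | no undominated =
    ⊥-elim (<-irrefl refl (≤-trans 2+k≤n (Undominated.n≤1+length-nonEdges w₀ undominated)))

  length-nonEdges≤ : ∀ {p} → p ≤ n C 2 → numEdges G ≡ n C 2 ∸ p → length nonEdges ≤ p
  length-nonEdges≤ {p} p≤C m≡C∸p = +-cancelˡ-≤ (numEdges G) _ _ (begin
    numEdges G + length nonEdges  ≤⟨ numEdges+length-nonEdges≤nC2 ⟩
    n C 2                         ≡⟨ m∸n+n≡m p≤C ⟨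
    (n C 2 ∸ p) + p               ≡⟨ cong (_+ p) m≡C∸p ⟨
    numEdges G + p                ∎)
    where open ≤-Reasoning

  tmc≥numEdges : 2 + length nonEdges ≤ n → TmcAtLeast G (numEdges G)
  tmc≥numEdges 2+k≤n =
    tmc-doubleStar (proj₂ (dominatingEdge 2+k≤n (Fin.fromℕ< (≤-trans (s≤s z≤n) 2+k≤n))))

  tmc≥numEdges+n∸2*length-nonEdges : 2 + length nonEdges ≤ n →
                                      TmcAtLeast G ((numEdges G + n) ∸ 2 * length nonEdges)
  tmc≥numEdges+n∸2*length-nonEdges 2+k≤n with universal?
  ... | yes (_ , universal) = tmc-star universal
  ... | no none = TmcAtLeast-mono (m≤n+o⇒m∸n≤o (numEdges G + n) _ (begin
    numEdges G + n                       ≡⟨ +-comm (numEdges G) n ⟩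
    n + numEdges G                       ≤⟨ +-monoˡ-≤ (numEdges G) (n≤2*length-nonEdges (λ w → none ∘ (w ,_))) ⟩
    2 * length nonEdges + numEdges G     ∎)) (tmc≥numEdges 2+k≤n)
    where open ≤-Reasoning

p+3≤n⇒p≤nC2 : ∀ {p n} → p + 3 ≤ n → p ≤ n C 2
p+3≤n⇒p≤nC2 {p} {zero} p+3≤0 with () ← m+n≤o⇒n≤o p p+3≤0
p+3≤n⇒p≤nC2 {p} {suc n} p+3≤1+n = begin
  p             ≤⟨ m+n≤o⇒n≤o 2 (≤-pred (subst (_≤ suc n) (+-comm p 3) p+3≤1+n)) ⟩
  n             ≤⟨ m≤m+n n (n C 2) ⟩
  n + n C 2     ≡⟨ cong (_+ n C 2) (nC1≡n n) ⟨
  n C 1 + n C 2 ≡⟨ nCk+nC[k+1]≡[n+1]C[k+1] n 1 ⟩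
  suc n C 2     ∎
  where open ≤-Reasoning

[C+n]∸3p≡[m+n]∸2p : ∀ {C m p} n → m ≡ C ∸ p → p ≤ C → (C + n) ∸ 3 * p ≡ (m + n) ∸ 2 * p
[C+n]∸3p≡[m+n]∸2p {C} {m} {p} n m≡C∸p p≤C = begin
  (C + n) ∸ 3 * p             ≡⟨ cong (λ c → (c + n) ∸ 3 * p) (m∸n+n≡m p≤C) ⟨
  ((C ∸ p) + p + n) ∸ 3 * p   ≡⟨ cong (λ c → (c + p + n) ∸ 3 * p) m≡C∸p ⟨
  (m + p + n) ∸ (p + 2 * p)   ≡⟨ cong (_∸ (p + 2 * p)) (rearrange m p n) ⟩
  (p + (m + n)) ∸ (p + 2 * p) ≡⟨ [m+n]∸[m+o]≡n∸o p (m + n) (2 * p) ⟩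
  (m + n) ∸ 2 * p             ∎
  where
  open ≡-Reasoning
  rearrange : ∀ m p n → m + p + n ≡ p + (m + n)
  rearrange = solve-∀

-- Neither connectedness nor the case split on 2p versus n is needed: both bounds hold outright.
lemma6 : (n p : ℕ) → p + 3 ≤ n → (G : Graph n) → Connected G
       → numEdges G ≡ (n C 2) ∸ p
       → (2 * p ≤ n → TmcAtLeast G (((n C 2) + n) ∸ (3 * p)))
       × (n < 2 * p → TmcAtLeast G ((n C 2) ∸ p))
lemma6 n p p+3≤n G _ m≡C∸p =
  (λ _ → TmcAtLeast-mono excess≤ (tmc≥numEdges+n∸2*length-nonEdges G 2+k≤n)) ,
  (λ _ → subst (TmcAtLeast G) m≡C∸p (tmc≥numEdges G 2+k≤n))
  where
  p≤C : p ≤ n C 2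
  p≤C = p+3≤n⇒p≤nC2 p+3≤n
  k≤p : length (nonEdges G) ≤ p
  k≤p = length-nonEdges≤ G p≤C m≡C∸p
  2+k≤n : 2 + length (nonEdges G) ≤ n
  2+k≤n = ≤-trans (+-monoʳ-≤ 2 k≤p) (≤-trans (n≤1+n (2 + p)) (subst (_≤ n) (+-comm p 3) p+3≤n))
  excess≤ : (n C 2 + n) ∸ 3 * p ≤ (numEdges G + n) ∸ 2 * length (nonEdges G)
  excess≤ = ≤-trans (≤-reflexive ([C+n]∸3p≡[m+n]∸2p n m≡C∸p p≤C)) (∸-monoʳ-≤ _ (*-monoʳ-≤ 2 k≤p))
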